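{- Let $p=2$ and let $k,r\ge0$ be integers. Then the following are minimal polynomial expressions: \[ \operatorname{argmax}^{(r)}(x_0,\dots,x_{(2k+3)2^r-1})=\operatorname{argmax}^{(r)}(x_0,\dots,x_{(2k+2)2^r-1}) =\sum_{i=0}^{k}(1+x_0)(1+x_1)\cdots(1+x_{(2i+1)2^r-1})\Bigl(\prod_{j=(2i+1)2^r}^{(2i+2)2^r-1}(1+x_j)-1\Bigr) =\sum_{i=1}^{2k+2}(1+x_0)(1+x_1)\cdots(1+x_{i\cdot2^r-1}). \] Moreover, for every $n\ge1$, $\operatorname{argmax}^{(r)}(x_0,\dots,x_{n-1})=\operatorname{argmax}^{(r)}(x_0,\dots,x_{n-1},0)$.
   Context: $\mathbb{F}_2$ is identified with $\{0,1\}$ with the usual ordering. For $x=(x_0,\dots,x_{m-1})\in\mathbb{F}_2{}^m$, $\operatorname{argmax}(x)$ is the least index $i$ with $x_i=\max(x_0,\dots,x_{m-1})$, and $\operatorname{argmax}^{(r)}(x)\in\mathbb{F}_2$ is the $r$-th binary digit of the integer $\operatorname{argmax}(x)$. A minimal polynomial expression is a polynomial over $\mathbb{F}_2$ of degree at most $1$ in each variable which coincides with the function on all inputs. -}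

module Defs where

open import Data.Bool using (Bool; true; false; _∧_; _∨_; _xor_; not; if_then_else_)
open import Data.Nat using (ℕ; zero; suc; _+_; _*_; _^_; _≤_; _⊔_; _≡ᵇ_; _/_; _%_)
open import Data.Product using (_×_)
open import Relation.Binary.PropositionalEquality using (_≡_)

-- F₂ is represented by Bool: false = 0, true = 1, addition = xor,
-- multiplication = ∧.  The usual order 0 < 1 is false < true, so the
-- maximum of two elements is _∨_.
-- An input (x₀, …, x_{n-1}) ∈ F₂ⁿ is given as a function x : ℕ → Bool of
-- which only the values x 0, …, x (n-1) are used.

maxF : ℕ → (ℕ → Bool) → Bool
maxF zero    x = false
maxF (suc n) x = maxF n x ∨ x n

-- least index i < n with x i ≡ b (returns n if there is none)
leastIdx : ℕ → (ℕ → Bool) → Bool → ℕ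
leastIdx zero    x b = zero
leastIdx (suc n) x b with leastIdx n x b
... | i = if i ≡ᵇ n then (if eqB (x n) b then n else suc n) else i
  where
  eqB : Bool → Bool → Bool
  eqB true  true  = true
  eqB false false = true
  eqB _     _     = false

argmax : ℕ → (ℕ → Bool) → ℕ
argmax n x = leastIdx n x (maxF n x)

bit : ℕ → ℕ → Bool
bit zero    a = a % 2 ≡ᵇ 1
bit (suc r) a = bit r (a / 2)

argmaxBit : ℕ → ℕ → (ℕ → Bool) → Bool
argmaxBit r n x = bit r (argmax n x)

extend0 : ℕ → (ℕ → Bool) → (ℕ → Bool)
extend0 n x i = if i ≡ᵇ n then false else x i

data Expr : Set where
  var  : ℕ → Expr
  zer  : Expr
  one  : Expr
  _⊕_  : Expr → Expr → Expr
  _⊗_  : Expr → Expr → Expr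

infixl 6 _⊕_
infixl 7 _⊗_

eval : Expr → (ℕ → Bool) → Bool
eval (var i) x = x i
eval zer     x = false
eval one     x = true
eval (a ⊕ b) x = eval a x xor eval b x
eval (a ⊗ b) x = eval a x ∧ eval b x

-- (upper bound for) the degree of an expression in the variable x_v
degIn : ℕ → Expr → ℕ
degIn v (var w) = if v ≡ᵇ w then 1 else 0
degIn v zer     = 0
degIn v one     = 0
degIn v (a ⊕ b) = degIn v a ⊔ degIn v b
degIn v (a ⊗ b) = degIn v a + degIn v b

data VarsBelow (n : ℕ) : Expr → Set where
  var  : ∀ {i} → suc i ≤ n → VarsBelow n (var i)
  zer  : VarsBelow n zer
  one  : VarsBelow n one
  _⊕_  : ∀ {a b} → VarsBelow n a → VarsBelow n b → VarsBelow n (a ⊕ b)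
  _⊗_  : ∀ {a b} → VarsBelow n a → VarsBelow n b → VarsBelow n (a ⊗ b)

IsMinPolyExpr : (n : ℕ) → ((ℕ → Bool) → Bool) → Expr → Set
IsMinPolyExpr n f e =
  VarsBelow n e × (∀ v → degIn v e ≤ 1) × (∀ x → eval e x ≡ f x)

prodFrom : ℕ → ℕ → Expr
prodFrom a zero      = one
prodFrom a (suc len) = prodFrom a len ⊗ (one ⊕ var (a + len))

sumE : ℕ → (ℕ → Expr) → Expr
sumE zero    f = zer
sumE (suc n) f = sumE n f ⊕ f n

-- ∑_{i=0}^{k} (1+x₀)⋯(1+x_{(2i+1)2^r-1}) ( ∏_{j=(2i+1)2^r}^{(2i+2)2^r-1}(1+x_j) - 1 )
-- (over F₂, "- 1" is "+ 1")
polyA : ℕ → ℕ → Expr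
polyA k r = sumE (suc k) (λ i →
  prodFrom 0 ((2 * i + 1) * 2 ^ r) ⊗ (prodFrom ((2 * i + 1) * 2 ^ r) (2 ^ r) ⊕ one))

polyB : ℕ → ℕ → Expr
polyB k r = sumE (2 * k + 2) (λ i → prodFrom 0 (suc i * 2 ^ r))

-- With all inputs zero the argmax is 0; otherwise it is the position f of
-- the first 1, and its r-th bit is the parity of the block index j with
-- j·2^r ≤ f < (j+1)·2^r.  The i-th summand of the second polynomial is the
-- indicator that the first (i+1)·2^r inputs vanish, so the sum counts, mod 2,
-- the blocks lying entirely before f, which is again j (or the even number of
-- summands when no 1 occurs early enough).  The summands of the first
-- polynomial are differences of consecutive summands of the second.
module Submission where

open import Defs
open import Data.Bool using (Bool; true; false; _∧_; _∨_; _xor_; not)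
open import Data.Bool.Properties using (∨-zeroʳ; ∧-assoc; ∧-identityʳ; xor-assoc; xor-comm; xor-identityʳ)
open import Data.Nat using (ℕ; zero; suc; _+_; _*_; _^_; _≤_; _<_; _≡ᵇ_; _%_; _/_; z≤n; z<s)
open import Data.Nat.Properties
open import Data.Nat.DivMod using ([m+kn]%n≡m%n; m*n%n≡0; m*n/n≡m; /-monoˡ-≤; m<n*o⇒m/o<n)
open import Data.Nat.Tactic.RingSolver using (solve-∀)
open import Data.Product using (_×_; _,_)
open import Data.Sum using (inj₁; inj₂)
open import Function using (_∘_)
open import Relation.Nullary using (yes; no)
open import Relation.Nullary.Decidable using (dec-true; dec-false)
open import Relation.Binary.PropositionalEquality

≡ᵇ-refl : ∀ n → (n ≡ᵇ n) ≡ true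
≡ᵇ-refl n = dec-true (n ≟ n) refl

≡ᵇ-≢ : ∀ {m n} → m ≢ n → (m ≡ᵇ n) ≡ false
≡ᵇ-≢ {m} {n} = dec-false (m ≟ n)

<-suc-cases : ∀ {i n} {P : ℕ → Set} → (i < n → P i) → P n → i < suc n → P i
<-suc-cases {P = P} below at i<1+n with m<1+n⇒m<n∨m≡n i<1+n
... | inj₁ i<n  = below i<n
... | inj₂ refl = at

module _ (x : ℕ → Bool) where

  maxF-false : ∀ n → (∀ {i} → i < n → x i ≡ false) → maxF n x ≡ false
  maxF-false zero    _        = refl
  maxF-false (suc n) allFalse =
    cong₂ _∨_ (maxF-false n (allFalse ∘ m<n⇒m<1+n)) (allFalse (n<1+n n))

  maxF-true : ∀ n {f} → f < n → x f ≡ true → maxF n x ≡ true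
  maxF-true (suc n) f<1+n xf with m<1+n⇒m<n∨m≡n f<1+n
  ... | inj₁ f<n  = cong (_∨ x n) (maxF-true n f<n xf)
  ... | inj₂ refl = trans (cong (maxF n x ∨_) xf) (∨-zeroʳ _)

  leastIdx-absent : ∀ n b → (∀ {i} → i < n → x i ≡ not b) → leastIdx n x b ≡ n
  leastIdx-absent zero    b _      = refl
  leastIdx-absent (suc n) b absent
    rewrite leastIdx-absent n b (absent ∘ m<n⇒m<1+n) | ≡ᵇ-refl n | absent (n<1+n n)
    with b
  ... | true  = refl
  ... | false = refl

  leastIdx-first : ∀ n b {f} → f < n → x f ≡ b → (∀ {i} → i < f → x i ≡ not b) →
                   leastIdx n x b ≡ f
  leastIdx-first (suc n) b f<1+n xf before with m<1+n⇒m<n∨m≡n f<1+n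
  ... | inj₁ f<n rewrite leastIdx-first n b f<n xf before | ≡ᵇ-≢ (<⇒≢ f<n) = refl
  ... | inj₂ refl rewrite leastIdx-absent n b before | ≡ᵇ-refl n | xf with b
  ...   | true  = refl
  ...   | false = refl

data FirstTrue (x : ℕ → Bool) (n : ℕ) : Set where
  none : (∀ {i} → i < n → x i ≡ false) → FirstTrue x n
  at   : ∀ {f} → f < n → x f ≡ true → (∀ {i} → i < f → x i ≡ false) → FirstTrue x n

firstTrue : ∀ x n → FirstTrue x n
firstTrue x zero = none λ ()
firstTrue x (suc n) with firstTrue x n
... | at f<n xf before = at (m<n⇒m<1+n f<n) xf before
... | none allFalse with x n in xn
...   | true  = at (n<1+n n) xn allFalse
...   | false = none (<-suc-cases {P = λ i → x i ≡ false} allFalse xn)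

argmax-none : ∀ {n x} → (∀ {i} → i < n → x i ≡ false) → argmax n x ≡ 0
argmax-none {zero}      _        = refl
argmax-none {suc n} {x} allFalse =
  trans (cong (leastIdx (suc n) x) (maxF-false x (suc n) allFalse))
        (leastIdx-first x (suc n) false z<s (allFalse z<s) λ ())

argmax-at : ∀ {n x f} → f < n → x f ≡ true → (∀ {i} → i < f → x i ≡ false) → argmax n x ≡ f
argmax-at {n} {x} f<n xf before =
  trans (cong (leastIdx n x) (maxF-true x n f<n xf)) (leastIdx-first x n true f<n xf before)

bit0-+2 : ∀ m → bit 0 (suc (suc m)) ≡ bit 0 m
bit0-+2 m = cong (_≡ᵇ 1) (trans (cong (_% 2) (+-comm 2 m)) ([m+kn]%n≡m%n m 1 2))

bit0-suc : ∀ m → bit 0 (suc m) ≡ not (bit 0 m)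
bit0-suc zero          = refl
bit0-suc (suc zero)    = refl
bit0-suc (suc (suc m)) = trans (bit0-+2 (suc m)) (trans (bit0-suc m) (cong not (sym (bit0-+2 m))))

bit0-even : ∀ k → bit 0 (2 * k + 2) ≡ false
bit0-even k = cong (_≡ᵇ 1) (trans (cong (_% 2) (2k+2≡[1+k]*2 k)) (m*n%n≡0 (suc k) 2))
  where
  2k+2≡[1+k]*2 : ∀ k → 2 * k + 2 ≡ suc k * 2
  2k+2≡[1+k]*2 = solve-∀

bit-zero : ∀ r → bit r 0 ≡ false
bit-zero zero    = refl
bit-zero (suc r) = bit-zero r

bit-block : ∀ r m {f} → m * 2 ^ r ≤ f → f < suc m * 2 ^ r → bit r f ≡ bit 0 m
bit-block zero m {f} lo hi =
  cong (bit 0) (≤-antisym (m<1+n⇒m≤n (subst (f <_) (*-identityʳ (suc m)) hi))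
                          (subst (_≤ f) (*-identityʳ m) lo))
bit-block (suc r) m {f} lo hi = bit-block r m lo′ hi′
  where
  reassoc : ∀ a → a * 2 ^ suc r ≡ a * 2 ^ r * 2
  reassoc a = trans (cong (a *_) (*-comm 2 (2 ^ r))) (sym (*-assoc a (2 ^ r) 2))
  lo′ : m * 2 ^ r ≤ f / 2
  lo′ = subst (_≤ f / 2) (m*n/n≡m (m * 2 ^ r) 2) (/-monoˡ-≤ 2 (subst (_≤ f) (reassoc m) lo))
  hi′ : f / 2 < suc m * 2 ^ r
  hi′ = m<n*o⇒m/o<n (subst (f <_) (reassoc (suc m)) hi)

prefixBlocks : ℕ → ℕ → Expr
prefixBlocks r M = sumE M (λ i → prodFrom 0 (suc i * 2 ^ r))

eval-prodFrom-+ : ∀ a m n x →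
                  eval (prodFrom a (m + n)) x ≡ eval (prodFrom a m) x ∧ eval (prodFrom (a + m) n) x
eval-prodFrom-+ a m zero x rewrite +-identityʳ m = sym (∧-identityʳ _)
eval-prodFrom-+ a m (suc n) x rewrite +-suc m n | eval-prodFrom-+ a m n x | +-assoc a m n =
  ∧-assoc (eval (prodFrom a m) x) _ _

eval-prodFrom-0 : ∀ m x → eval (prodFrom 0 m) x ≡ not (maxF m x)
eval-prodFrom-0 zero    x = refl
eval-prodFrom-0 (suc m) x rewrite eval-prodFrom-0 m x with maxF m x
... | true  = refl
... | false = refl

module _ (r : ℕ) (x : ℕ → Bool) where

  blocks-none : ∀ M → (∀ {i} → i < M * 2 ^ r → x i ≡ false) →
                eval (prefixBlocks r M) x ≡ bit 0 M
  blocks-none zero    _        = refl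
  blocks-none (suc M) allFalse = begin
    eval (prefixBlocks r M) x xor eval (prodFrom 0 (suc M * 2 ^ r)) x
      ≡⟨ cong₂ _xor_ (blocks-none M (allFalse ∘ λ i< → <-≤-trans i< (*-monoˡ-≤ (2 ^ r) (n≤1+n M))))
                     (trans (eval-prodFrom-0 (suc M * 2 ^ r) x) (cong not (maxF-false x _ allFalse))) ⟩
    bit 0 M xor true
      ≡⟨ xor-comm (bit 0 M) true ⟩
    not (bit 0 M)
      ≡⟨ sym (bit0-suc M) ⟩
    bit 0 (suc M) ∎
    where open ≡-Reasoning

  blocks-at : ∀ M {f} → f < suc M * 2 ^ r → x f ≡ true → (∀ {i} → i < f → x i ≡ false) →
              eval (prefixBlocks r M) x ≡ bit r f
  blocks-at M {f} f<n xf before with f <? M * 2 ^ r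
  blocks-at zero    f<n xf before | yes ()
  blocks-at (suc M) f<n xf before | yes f<M =
    trans (cong₂ _xor_ (blocks-at M f<M xf before) lastFalse) (xor-identityʳ _)
    where
    lastFalse : eval (prodFrom 0 (suc M * 2 ^ r)) x ≡ false
    lastFalse = trans (eval-prodFrom-0 (suc M * 2 ^ r) x) (cong not (maxF-true x _ f<M xf))
  blocks-at M       f<n xf before | no f≮M =
    trans (blocks-none M (before ∘ λ i< → <-≤-trans i< (≮⇒≥ f≮M)))
          (sym (bit-block r M (≮⇒≥ f≮M) f<n))

  argmaxBit-blocks : ∀ M {n} → bit 0 M ≡ false → M * 2 ^ r ≤ n → n ≤ suc M * 2 ^ r →
                     argmaxBit r n x ≡ eval (prefixBlocks r M) x
  argmaxBit-blocks M {n} even lo hi with firstTrue x n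
  ... | none allFalse = begin
    bit r (argmax n x)         ≡⟨ cong (bit r) (argmax-none allFalse) ⟩
    bit r 0                    ≡⟨ bit-zero r ⟩
    false                      ≡⟨ sym even ⟩
    bit 0 M                    ≡⟨ sym (blocks-none M (allFalse ∘ λ i< → <-≤-trans i< lo)) ⟩
    eval (prefixBlocks r M) x  ∎
    where open ≡-Reasoning
  ... | at f<n xf before =
    trans (cong (bit r) (argmax-at f<n xf before)) (sym (blocks-at M (<-≤-trans f<n hi) xf before))

prefixDiff : ℕ → ℕ → Expr
prefixDiff A B = prodFrom 0 A ⊗ (prodFrom A B ⊕ one)

eval-prefixDiff : ∀ A B x →
                  eval (prefixDiff A B) x ≡ eval (prodFrom 0 A) x xor eval (prodFrom 0 (A + B)) x
eval-prefixDiff A B x =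
  trans (∧-xor-true (eval (prodFrom 0 A) x) (eval (prodFrom A B) x))
        (cong (eval (prodFrom 0 A) x xor_) (sym (eval-prodFrom-+ 0 A B x)))
  where
  ∧-xor-true : ∀ a b → a ∧ (b xor true) ≡ a xor (a ∧ b)
  ∧-xor-true false b = refl
  ∧-xor-true true  b = xor-comm b true

eval-sumE-pairs : ∀ (f g : ℕ → Expr) x →
                  (∀ i → eval (g i) x ≡ eval (f (2 * i)) x xor eval (f (suc (2 * i))) x) →
                  ∀ n → eval (sumE n g) x ≡ eval (sumE (2 * n) f) x
eval-sumE-pairs f g x pair zero    = refl
eval-sumE-pairs f g x pair (suc n) = begin
  eval (sumE n g) x xor eval (g n) x
    ≡⟨ cong₂ _xor_ (eval-sumE-pairs f g x pair n) (pair n) ⟩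
  eval (sumE (2 * n) f) x xor (eval (f (2 * n)) x xor eval (f (suc (2 * n))) x)
    ≡⟨ sym (xor-assoc (eval (sumE (2 * n) f) x) _ _) ⟩
  eval (sumE (2 + 2 * n) f) x
    ≡⟨ cong (λ m → eval (sumE m f) x) (sym (*-suc 2 n)) ⟩
  eval (sumE (2 * suc n) f) x ∎
  where open ≡-Reasoning

eval-polyA≡eval-polyB : ∀ k r x → eval (polyA k r) x ≡ eval (polyB k r) x
eval-polyA≡eval-polyB k r x =
  trans (eval-sumE-pairs _ _ x pair (suc k)) (cong (λ m → eval (prefixBlocks r m) x) (2[1+k]≡2k+2 k))
  where
  2[1+k]≡2k+2 : ∀ k → 2 * suc k ≡ 2 * k + 2
  2[1+k]≡2k+2 = solve-∀
  [2i+1]p≡[1+2i]p : ∀ i p → (2 * i + 1) * p ≡ suc (2 * i) * p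
  [2i+1]p≡[1+2i]p = solve-∀
  [2i+1]p+p≡[2+2i]p : ∀ i p → (2 * i + 1) * p + p ≡ suc (suc (2 * i)) * p
  [2i+1]p+p≡[2+2i]p = solve-∀
  pair : ∀ i → eval (prefixDiff ((2 * i + 1) * 2 ^ r) (2 ^ r)) x ≡
               eval (prodFrom 0 (suc (2 * i) * 2 ^ r)) x xor eval (prodFrom 0 (suc (suc (2 * i)) * 2 ^ r)) x
  pair i = trans (eval-prefixDiff ((2 * i + 1) * 2 ^ r) (2 ^ r) x)
                 (cong₂ (λ a b → eval (prodFrom 0 a) x xor eval (prodFrom 0 b) x)
                        ([2i+1]p≡[1+2i]p i (2 ^ r)) ([2i+1]p+p≡[2+2i]p i (2 ^ r)))

VarsBelow-mono : ∀ {m n e} → m ≤ n → VarsBelow m e → VarsBelow n e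
VarsBelow-mono m≤n (var i<m) = var (≤-trans i<m m≤n)
VarsBelow-mono m≤n zer       = zer
VarsBelow-mono m≤n one       = one
VarsBelow-mono m≤n (a ⊕ b)   = VarsBelow-mono m≤n a ⊕ VarsBelow-mono m≤n b
VarsBelow-mono m≤n (a ⊗ b)   = VarsBelow-mono m≤n a ⊗ VarsBelow-mono m≤n b

VarsBelow-prodFrom : ∀ a len → VarsBelow (a + len) (prodFrom a len)
VarsBelow-prodFrom a zero      = one
VarsBelow-prodFrom a (suc len) =
  VarsBelow-mono (+-monoʳ-≤ a (n≤1+n len)) (VarsBelow-prodFrom a len)
  ⊗ (one ⊕ var (≤-reflexive (sym (+-suc a len))))

VarsBelow-sumE : ∀ {n} m f → (∀ {i} → i < m → VarsBelow n (f i)) → VarsBelow n (sumE m f)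
VarsBelow-sumE zero    f _     = zer
VarsBelow-sumE (suc m) f below = VarsBelow-sumE m f (below ∘ m<n⇒m<1+n) ⊕ below (n<1+n m)

VarsBelow-prefixDiff : ∀ A B → VarsBelow (A + B) (prefixDiff A B)
VarsBelow-prefixDiff A B =
  VarsBelow-mono (m≤m+n A B) (VarsBelow-prodFrom 0 A) ⊗ (VarsBelow-prodFrom A B ⊕ one)

VarsBelow-prefixBlocks : ∀ r M → VarsBelow (M * 2 ^ r) (prefixBlocks r M)
VarsBelow-prefixBlocks r M =
  VarsBelow-sumE M _ λ i<M → VarsBelow-mono (*-monoˡ-≤ (2 ^ r) i<M) (VarsBelow-prodFrom 0 _)

VarsBelow-polyA : ∀ k r → VarsBelow ((2 * k + 2) * 2 ^ r) (polyA k r)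
VarsBelow-polyA k r = VarsBelow-sumE (suc k) _ λ {i} i≤k →
  VarsBelow-mono (subst (_≤ (2 * k + 2) * 2 ^ r) (sym ([2i+1]p+p≡[2i+2]p i (2 ^ r)))
                        (*-monoˡ-≤ (2 ^ r) (+-monoˡ-≤ 2 (*-monoʳ-≤ 2 (m<1+n⇒m≤n i≤k)))))
                 (VarsBelow-prefixDiff _ _)
  where
  [2i+1]p+p≡[2i+2]p : ∀ i p → (2 * i + 1) * p + p ≡ (2 * i + 2) * p
  [2i+1]p+p≡[2i+2]p = solve-∀

degIn-var-≢ : ∀ {v w} → v ≢ w → degIn v (var w) ≡ 0
degIn-var-≢ v≢w rewrite ≡ᵇ-≢ v≢w = refl

degIn-prodFrom-≥ : ∀ {v} a len → a + len ≤ v → degIn v (prodFrom a len) ≡ 0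
degIn-prodFrom-≥ a zero      _ = refl
degIn-prodFrom-≥ a (suc len) p = cong₂ _+_
  (degIn-prodFrom-≥ a len (≤-trans (+-monoʳ-≤ a (n≤1+n len)) p))
  (degIn-var-≢ (≢-sym (<⇒≢ (<-≤-trans (≤-reflexive (sym (+-suc a len))) p))))

degIn-prodFrom-< : ∀ {v} a len → v < a → degIn v (prodFrom a len) ≡ 0
degIn-prodFrom-< a zero      _   = refl
degIn-prodFrom-< a (suc len) v<a = cong₂ _+_
  (degIn-prodFrom-< a len v<a) (degIn-var-≢ (<⇒≢ (<-≤-trans v<a (m≤m+n a len))))

degIn-prodFrom-≤1 : ∀ v a len → degIn v (prodFrom a len) ≤ 1
degIn-prodFrom-≤1 v a zero = z≤n
degIn-prodFrom-≤1 v a (suc len) with v ≟ a + len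
... | yes refl rewrite degIn-prodFrom-≥ {v} a len ≤-refl | ≡ᵇ-refl v = ≤-refl
... | no  v≢   rewrite degIn-var-≢ v≢ | +-identityʳ (degIn v (prodFrom a len)) =
  degIn-prodFrom-≤1 v a len

degIn-sumE-≤ : ∀ {v d} m f → (∀ i → degIn v (f i) ≤ d) → degIn v (sumE m f) ≤ d
degIn-sumE-≤ zero    f _     = z≤n
degIn-sumE-≤ (suc m) f bound = ⊔-lub (degIn-sumE-≤ m f bound) (bound m)

degIn-prefixDiff-≤1 : ∀ v A B → degIn v (prefixDiff A B) ≤ 1
degIn-prefixDiff-≤1 v A B with v <? A
... | yes v<A rewrite degIn-prodFrom-< A B v<A | +-identityʳ (degIn v (prodFrom 0 A)) =
  degIn-prodFrom-≤1 v 0 A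
... | no  v≮A rewrite degIn-prodFrom-≥ 0 A (≮⇒≥ v≮A) | ⊔-identityʳ (degIn v (prodFrom A B)) =
  degIn-prodFrom-≤1 v A B

extend0-< : ∀ {n i} x → i < n → extend0 n x i ≡ x i
extend0-< x i<n rewrite ≡ᵇ-≢ (<⇒≢ i<n) = refl

extend0-self : ∀ n x → extend0 n x n ≡ false
extend0-self n x rewrite ≡ᵇ-refl n = refl

argmax-extend0 : ∀ n x → argmax (suc n) (extend0 n x) ≡ argmax n x
argmax-extend0 n x with firstTrue x n
... | none allFalse = trans (argmax-none extendedFalse) (sym (argmax-none allFalse))
  where
  extendedFalse : ∀ {i} → i < suc n → extend0 n x i ≡ false
  extendedFalse = <-suc-cases {P = λ i → extend0 n x i ≡ false}
                              (λ i<n → trans (extend0-< x i<n) (allFalse i<n)) (extend0-self n x)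
... | at {f} f<n xf before =
  trans (argmax-at (m<n⇒m<1+n f<n) (trans (extend0-< x f<n) xf) extendedBefore)
        (sym (argmax-at f<n xf before))
  where
  extendedBefore : ∀ {i} → i < f → extend0 n x i ≡ false
  extendedBefore i<f = trans (extend0-< x (<-trans i<f f<n)) (before i<f)

polyB-argmaxBit : ∀ k r {n} → (2 * k + 2) * 2 ^ r ≤ n → n ≤ (2 * k + 3) * 2 ^ r →
                  ∀ x → eval (polyB k r) x ≡ argmaxBit r n x
polyB-argmaxBit k r lo hi x =
  sym (argmaxBit-blocks r x (2 * k + 2) (bit0-even k) lo
                        (≤-trans hi (≤-reflexive (cong (_* 2 ^ r) (+-suc (2 * k) 2)))))

polyA-isMinPoly : ∀ k r {n} → (2 * k + 2) * 2 ^ r ≤ n → n ≤ (2 * k + 3) * 2 ^ r →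
                  IsMinPolyExpr n (argmaxBit r n) (polyA k r)
polyA-isMinPoly k r lo hi =
    VarsBelow-mono lo (VarsBelow-polyA k r)
  , (λ v → degIn-sumE-≤ (suc k) _ λ i → degIn-prefixDiff-≤1 v ((2 * i + 1) * 2 ^ r) (2 ^ r))
  , λ x → trans (eval-polyA≡eval-polyB k r x) (polyB-argmaxBit k r lo hi x)

polyB-isMinPoly : ∀ k r {n} → (2 * k + 2) * 2 ^ r ≤ n → n ≤ (2 * k + 3) * 2 ^ r →
                  IsMinPolyExpr n (argmaxBit r n) (polyB k r)
polyB-isMinPoly k r lo hi =
    VarsBelow-mono lo (VarsBelow-prefixBlocks r (2 * k + 2))
  , (λ v → degIn-sumE-≤ (2 * k + 2) _ λ i → degIn-prodFrom-≤1 v 0 (suc i * 2 ^ r))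
  , polyB-argmaxBit k r lo hi

proposition4p3 : (k r : ℕ) →
      IsMinPolyExpr ((2 * k + 3) * 2 ^ r) (argmaxBit r ((2 * k + 3) * 2 ^ r)) (polyA k r)
    × IsMinPolyExpr ((2 * k + 3) * 2 ^ r) (argmaxBit r ((2 * k + 3) * 2 ^ r)) (polyB k r)
    × IsMinPolyExpr ((2 * k + 2) * 2 ^ r) (argmaxBit r ((2 * k + 2) * 2 ^ r)) (polyA k r)
    × IsMinPolyExpr ((2 * k + 2) * 2 ^ r) (argmaxBit r ((2 * k + 2) * 2 ^ r)) (polyB k r)
    × (∀ (x : ℕ → Bool) → argmaxBit r ((2 * k + 3) * 2 ^ r) x ≡ argmaxBit r ((2 * k + 2) * 2 ^ r) x)
    × (∀ (n : ℕ) → 1 ≤ n → ∀ (x : ℕ → Bool) → argmaxBit r n x ≡ argmaxBit r (suc n) (extend0 n x))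
proposition4p3 k r =
    polyA-isMinPoly k r N₂≤N₃ ≤-refl
  , polyB-isMinPoly k r N₂≤N₃ ≤-refl
  , polyA-isMinPoly k r ≤-refl N₂≤N₃
  , polyB-isMinPoly k r ≤-refl N₂≤N₃
  , (λ x → trans (sym (polyB-argmaxBit k r N₂≤N₃ ≤-refl x)) (polyB-argmaxBit k r ≤-refl N₂≤N₃ x))
  , λ n _ x → cong (bit r) (sym (argmax-extend0 n x))
  where
  N₂≤N₃ : (2 * k + 2) * 2 ^ r ≤ (2 * k + 3) * 2 ^ r
  N₂≤N₃ = *-monoˡ-≤ (2 ^ r) (+-monoʳ-≤ (2 * k) (n≤1+n 2))
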